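{- Let $(A,\mathbf{U}_A)$, $(B,\mathbf{U}_B)$, $(C,\mathbf{U}_C)$ be uniform groupoids, $S\in\mathbf{U}_{A\multimap B}$ and $T\in\mathbf{U}_{B\multimap C}$. Then $T\odot S\in\mathbf{U}_{A\multimap C}$.
   Context: All groupoids are small. Prestrategies. A prestrategy on $A$ is $(S,\partial^S:S\to A)$; one from $A$ to $B$ is a prestrategy on $A\times B$, with $\partial^S=\langle\partial^S_A,\partial^S_B\rangle$. Bipullbacks. For a cospan $S\xrightarrow{u}B\xleftarrow{v}T$: - a pseudocone with vertex $X$ is $(l',r',\nu:ul'\Rightarrow vr')$; - a morphism of pseudocones is $(\alpha:l'\Rightarrow l'',\beta:r'\Rightarrow r'')$ with $\nu''\circ u\alpha=v\beta\circ\nu$; - $(P,l,r,\mu)$ is a bipullback if for every $X$ the functor $h\mapsto(lh,rh,\mu h)$ from functors $X\to P$ to pseudocones with vertex $X$ is an equivalence of categories; - commuting squares carry identity $2$-cells. Uniform groupoids. $S\perp T$ (prestrategies on $B$) iff the pullback of $S\to B\leftarrow T$ is a bipullback, and $\mathbf{S}^\perp=\{T\mid\forall S\in\mathbf{S},S\perp T\}$. A uniform groupoid is $(A,\mathbf{U}_A)$ with $\mathbf{U}_A^{\perp\perp}=\mathbf{U}_A$. $A\multimap B$ has underlying groupoid $A\times B$ and $\mathbf{U}_{A\multimap B}=\{(S\times U,\partial^S\times\partial^U)\mid S\in\mathbf{U}_A,U\in\mathbf{U}_B^\perp\}^\perp$. Composition. For $S$ from $A$ to $B$ and $T$ from $B$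 to $C$, $T\odot S$ is the pullback $P$ of $S\xrightarrow{\partial^S_B}B\xleftarrow{\partial^T_B}T$, with projections $l,r$ and display $\langle\partial^S_Al,\partial^T_Cr\rangle:P\to A\times C$. -}

module Defs where

open import Level using (0ℓ)
open import Data.Product using (Σ; Σ-syntax; _×_; _,_; proj₁; proj₂)
open import Relation.Binary using (Rel; IsEquivalence)
open import Relation.Binary.PropositionalEquality using (_≡_; refl)

record Groupoid : Set₁ where
  infixr 9 _∘_
  infix 4 _≈_
  field
    Obj : Set
    _⇒_ : Obj → Obj → Set
    _≈_ : ∀ {a b} → Rel (a ⇒ b) 0ℓ
    ≈-equiv : ∀ {a b} → IsEquivalence (_≈_ {a} {b})
    id : ∀ {a} → a ⇒ a
    _∘_ : ∀ {a b c} → b ⇒ c → a ⇒ b → a ⇒ c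
    _⁻¹ : ∀ {a b} → a ⇒ b → b ⇒ a
    assoc : ∀ {a b c d} {f : a ⇒ b} {g : b ⇒ c} {h : c ⇒ d} →
            (h ∘ g) ∘ f ≈ h ∘ (g ∘ f)
    identityˡ : ∀ {a b} {f : a ⇒ b} → id ∘ f ≈ f
    identityʳ : ∀ {a b} {f : a ⇒ b} → f ∘ id ≈ f
    ∘-resp-≈ : ∀ {a b c} {f f' : b ⇒ c} {g g' : a ⇒ b} →
               f ≈ f' → g ≈ g' → f ∘ g ≈ f' ∘ g'
    inverseˡ : ∀ {a b} {f : a ⇒ b} → f ⁻¹ ∘ f ≈ id
    inverseʳ : ∀ {a b} {f : a ⇒ b} → f ∘ f ⁻¹ ≈ id

  module E {a b} = IsEquivalence (≈-equiv {a} {b})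

  infixr 4 _▸_
  _▸_ : ∀ {a b} {f g h : a ⇒ b} → f ≈ g → g ≈ h → f ≈ h
  p ▸ q = E.trans p q

  ≈sym : ∀ {a b} {f g : a ⇒ b} → f ≈ g → g ≈ f
  ≈sym = E.sym

  ≈refl : ∀ {a b} {f : a ⇒ b} → f ≈ f
  ≈refl = E.refl

  square-inv : ∀ {p q r s} {a : p ⇒ r} {a' : q ⇒ s} {x : p ⇒ q} {x' : q ⇒ p}
               {y : r ⇒ s} {y' : s ⇒ r} →
               x ∘ x' ≈ id → y' ∘ y ≈ id → a' ∘ x ≈ y ∘ a → a ∘ x' ≈ y' ∘ a'
  square-inv {a = a} {a'} {x} {x'} {y} {y'} xx' y'y c =
    ≈sym identityˡ
    ▸ ∘-resp-≈ (≈sym y'y) ≈refl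
    ▸ assoc
    ▸ ∘-resp-≈ ≈refl (≈sym assoc)
    ▸ ∘-resp-≈ ≈refl (∘-resp-≈ (≈sym c) ≈refl)
    ▸ ∘-resp-≈ ≈refl assoc
    ▸ ∘-resp-≈ ≈refl (∘-resp-≈ ≈refl xx')
    ▸ ∘-resp-≈ ≈refl identityʳ

open Groupoid public using (Obj)

infix 4 _[_,_]
_[_,_] : (G : Groupoid) → Groupoid.Obj G → Groupoid.Obj G → Set
G [ a , b ] = Groupoid._⇒_ G a b

infix 4 _[_≈_]
_[_≈_] : (G : Groupoid) → ∀ {a b} → G [ a , b ] → G [ a , b ] → Set
G [ f ≈ g ] = Groupoid._≈_ G f g

_[_∘_] : (G : Groupoid) → ∀ {a b c} → G [ b , c ] → G [ a , b ] → G [ a , c ]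
G [ f ∘ g ] = Groupoid._∘_ G f g

record Functor (X Y : Groupoid) : Set where
  private
    module X = Groupoid X
    module Y = Groupoid Y
  field
    F₀ : X.Obj → Y.Obj
    F₁ : ∀ {a b} → X [ a , b ] → Y [ F₀ a , F₀ b ]
    F-resp-≈ : ∀ {a b} {f g : X [ a , b ]} → X [ f ≈ g ] → Y [ F₁ f ≈ F₁ g ]
    F-id : ∀ {a} → Y [ F₁ (X.id {a}) ≈ Y.id ]
    F-∘ : ∀ {a b c} {f : X [ a , b ]} {g : X [ b , c ]} →
          Y [ F₁ (X [ g ∘ f ]) ≈ Y [ F₁ g ∘ F₁ f ] ]

open Functor public

infixr 9 _∘F_
_∘F_ : ∀ {X Y Z} → Functor Y Z → Functor X Y → Functor X Z
_∘F_ {X} {Y} {Z} G F = record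
  { F₀ = λ x → F₀ G (F₀ F x)
  ; F₁ = λ f → F₁ G (F₁ F f)
  ; F-resp-≈ = λ p → F-resp-≈ G (F-resp-≈ F p)
  ; F-id = F-resp-≈ G (F-id F) ▸ F-id G
  ; F-∘ = F-resp-≈ G (F-∘ F) ▸ F-∘ G
  }
  where open Groupoid Z using (_▸_)

infixr 7 _×G_
_×G_ : Groupoid → Groupoid → Groupoid
A ×G B = record
  { Obj = A.Obj × B.Obj
  ; _⇒_ = λ x y → A [ proj₁ x , proj₁ y ] × B [ proj₂ x , proj₂ y ]
  ; _≈_ = λ f g → A [ proj₁ f ≈ proj₁ g ] × B [ proj₂ f ≈ proj₂ g ]
  ; ≈-equiv = record
      { refl = A.≈refl , B.≈refl
      ; sym = λ p → A.≈sym (proj₁ p) , B.≈sym (proj₂ p)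
      ; trans = λ p q → A.E.trans (proj₁ p) (proj₁ q) , B.E.trans (proj₂ p) (proj₂ q)
      }
  ; id = A.id , B.id
  ; _∘_ = λ g f → A [ proj₁ g ∘ proj₁ f ] , B [ proj₂ g ∘ proj₂ f ]
  ; _⁻¹ = λ f → A._⁻¹ (proj₁ f) , B._⁻¹ (proj₂ f)
  ; assoc = A.assoc , B.assoc
  ; identityˡ = A.identityˡ , B.identityˡ
  ; identityʳ = A.identityʳ , B.identityʳ
  ; ∘-resp-≈ = λ p q → A.∘-resp-≈ (proj₁ p) (proj₁ q) , B.∘-resp-≈ (proj₂ p) (proj₂ q)
  ; inverseˡ = A.inverseˡ , B.inverseˡ
  ; inverseʳ = A.inverseʳ , B.inverseʳ
  }
  where
    module A = Groupoid A
    module B = Groupoid B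

πˡ : ∀ {A B} → Functor (A ×G B) A
πˡ {A} = record
  { F₀ = proj₁ ; F₁ = proj₁ ; F-resp-≈ = proj₁
  ; F-id = Groupoid.≈refl A ; F-∘ = Groupoid.≈refl A }

πʳ : ∀ {A B} → Functor (A ×G B) B
πʳ {B = B} = record
  { F₀ = proj₂ ; F₁ = proj₂ ; F-resp-≈ = proj₂
  ; F-id = Groupoid.≈refl B ; F-∘ = Groupoid.≈refl B }

⟨_,_⟩F : ∀ {X A B} → Functor X A → Functor X B → Functor X (A ×G B)
⟨ F , G ⟩F = record
  { F₀ = λ x → F₀ F x , F₀ G x
  ; F₁ = λ f → F₁ F f , F₁ G f
  ; F-resp-≈ = λ p → F-resp-≈ F p , F-resp-≈ G p
  ; F-id = F-id F , F-id G
  ; F-∘ = F-∘ F , F-∘ G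
  }

_⁂_ : ∀ {X Y A B} → Functor X A → Functor Y B → Functor (X ×G Y) (A ×G B)
F ⁂ G = ⟨ F ∘F πˡ , G ∘F πʳ ⟩F

record NatTrans {X Y : Groupoid} (F G : Functor X Y) : Set where
  field
    η : ∀ x → Y [ F₀ F x , F₀ G x ]
    commute : ∀ {x x'} (f : X [ x , x' ]) →
              Y [ Y [ η x' ∘ F₁ F f ] ≈ Y [ F₁ G f ∘ η x ] ]

open NatTrans public

module _ {S T B : Groupoid} (u : Functor S B) (v : Functor T B) where

  record Pseudocone (X : Groupoid) : Set where
    field
      l : Functor X S
      r : Functor X T
      ν : NatTrans (u ∘F l) (v ∘F r)

  open Pseudocone

  record PseudoconeMor {X : Groupoid} (c d : Pseudocone X) : Set where
    field
      α : NatTrans (l c) (l d)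
      β : NatTrans (r c) (r d)
      coh : ∀ x → B [ B [ η (ν d) x ∘ F₁ u (η α x) ]
                      ≈ B [ F₁ v (η β x) ∘ η (ν c) x ] ]

  open PseudoconeMor

  _≈PM_ : ∀ {X} {c d : Pseudocone X} → PseudoconeMor c d → PseudoconeMor c d → Set
  _≈PM_ {X} m m' =
    ∀ x → (S [ η (α m) x ≈ η (α m') x ]) × (T [ η (β m) x ≈ η (β m') x ])

  precomp : ∀ {P X} → Pseudocone P → Functor X P → Pseudocone X
  precomp c h = record
    { l = l c ∘F h
    ; r = r c ∘F h
    ; ν = record { η = λ x → η (ν c) (F₀ h x)
                 ; commute = λ f → commute (ν c) (F₁ h f) }
    }

  precompMor : ∀ {P X} (c : Pseudocone P) {h h' : Functor X P} →
               NatTrans h h' → PseudoconeMor (precomp c h) (precomp c h')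
  precompMor {P} {X} c {h} {h'} θ = record
    { α = record
        { η = λ x → F₁ (l c) (η θ x)
        ; commute = λ f → S.≈sym (F-∘ (l c))
                          S.▸ F-resp-≈ (l c) (commute θ f)
                          S.▸ F-∘ (l c) }
    ; β = record
        { η = λ x → F₁ (r c) (η θ x)
        ; commute = λ f → T.≈sym (F-∘ (r c))
                          T.▸ F-resp-≈ (r c) (commute θ f)
                          T.▸ F-∘ (r c) }
    ; coh = λ x → commute (ν c) (η θ x)
    }
    where
      module S = Groupoid S
      module T = Groupoid T

  -- (P , c) is a bipullback: for every X the functor h ↦ c ∘ h is an
  -- equivalence of categories, expressed as: fully faithful and
  -- (split) essentially surjective.
  record IsEquivalenceAt {P : Groupoid} (c : Pseudocone P) (X : Groupoid) : Set₁ where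
    field
      faithful : ∀ {h h' : Functor X P} (θ θ' : NatTrans h h') →
                 precompMor c θ ≈PM precompMor c θ' →
                 ∀ x → P [ η θ x ≈ η θ' x ]
      full : ∀ {h h' : Functor X P} (m : PseudoconeMor (precomp c h) (precomp c h')) →
             Σ[ θ ∈ NatTrans h h' ] (precompMor c θ ≈PM m)
      essSurj : ∀ (d : Pseudocone X) →
                Σ[ h ∈ Functor X P ] PseudoconeMor (precomp c h) d

  IsBipullback : (P : Groupoid) → Pseudocone P → Set₁
  IsBipullback P c = ∀ (X : Groupoid) → IsEquivalenceAt c X

cast : ∀ {B : Groupoid} {x y : Obj B} → x ≡ y → B [ x , y ]
cast {B} refl = Groupoid.id B

module Pullback {S T B : Groupoid} (u : Functor S B) (v : Functor T B) where
  private
    module S = Groupoid S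
    module T = Groupoid T
    module B = Groupoid B

  PObj : Set
  PObj = Σ[ s ∈ S.Obj ] Σ[ t ∈ T.Obj ] (F₀ u s ≡ F₀ v t)

  μ₀ : (p : PObj) → B [ F₀ u (proj₁ p) , F₀ v (proj₁ (proj₂ p)) ]
  μ₀ (s , t , e) = cast {B} e

  record PHom (p q : PObj) : Set where
    constructor phom
    field
      hs : S [ proj₁ p , proj₁ q ]
      ht : T [ proj₁ (proj₂ p) , proj₁ (proj₂ q) ]
      hc : B [ B [ μ₀ q ∘ F₁ u hs ] ≈ B [ F₁ v ht ∘ μ₀ p ] ]
  open PHom

  private
    pid : ∀ {p} → PHom p p
    pid {p} = phom S.id T.id
      ( B.∘-resp-≈ B.≈refl (F-id u) B.▸ B.identityʳ
        B.▸ B.≈sym B.identityˡ B.▸ B.∘-resp-≈ (B.≈sym (F-id v)) B.≈refl )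

    pcomp : ∀ {p q r} → PHom q r → PHom p q → PHom p r
    pcomp {p} {q} {r} (phom f' g' c') (phom f g c) = phom (S [ f' ∘ f ]) (T [ g' ∘ g ])
      ( B.∘-resp-≈ B.≈refl (F-∘ u)
        B.▸ B.≈sym B.assoc
        B.▸ B.∘-resp-≈ c' B.≈refl
        B.▸ B.assoc
        B.▸ B.∘-resp-≈ B.≈refl c
        B.▸ B.≈sym B.assoc
        B.▸ B.∘-resp-≈ (B.≈sym (F-∘ v)) B.≈refl )

    pinv : ∀ {p q} → PHom p q → PHom q p
    pinv (phom f g c) = phom (S._⁻¹ f) (T._⁻¹ g)
      (B.square-inv
        (B.≈sym (F-∘ u) B.▸ F-resp-≈ u S.inverseʳ B.▸ F-id u)
        (B.≈sym (F-∘ v) B.▸ F-resp-≈ v T.inverseˡ B.▸ F-id v)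
        c)

  P : Groupoid
  P = record
    { Obj = PObj
    ; _⇒_ = PHom
    ; _≈_ = λ f g → S [ hs f ≈ hs g ] × T [ ht f ≈ ht g ]
    ; ≈-equiv = record
        { refl = S.≈refl , T.≈refl
        ; sym = λ e → S.≈sym (proj₁ e) , T.≈sym (proj₂ e)
        ; trans = λ e e' → S.E.trans (proj₁ e) (proj₁ e') , T.E.trans (proj₂ e) (proj₂ e')
        }
    ; id = pid
    ; _∘_ = pcomp
    ; _⁻¹ = pinv
    ; assoc = S.assoc , T.assoc
    ; identityˡ = S.identityˡ , T.identityˡ
    ; identityʳ = S.identityʳ , T.identityʳ
    ; ∘-resp-≈ = λ e e' → S.∘-resp-≈ (proj₁ e) (proj₁ e') , T.∘-resp-≈ (proj₂ e) (proj₂ e')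
    ; inverseˡ = S.inverseˡ , T.inverseˡ
    ; inverseʳ = S.inverseʳ , T.inverseʳ
    }

  l : Functor P S
  l = record { F₀ = proj₁ ; F₁ = hs ; F-resp-≈ = proj₁ ; F-id = S.≈refl ; F-∘ = S.≈refl }

  r : Functor P T
  r = record { F₀ = λ p → proj₁ (proj₂ p) ; F₁ = ht ; F-resp-≈ = proj₂
             ; F-id = T.≈refl ; F-∘ = T.≈refl }

  cone : Pseudocone u v P
  cone = record { l = l ; r = r ; ν = record { η = μ₀ ; commute = hc } }

record Prestrategy (A : Groupoid) : Set₁ where
  field
    S : Groupoid
    ∂ : Functor S A

open Prestrategy public

infix 4 _⊥_
_⊥_ : ∀ {B} → Prestrategy B → Prestrategy B → Set₁
σ ⊥ τ = IsBipullback (∂ σ) (∂ τ) (Pullback.P (∂ σ) (∂ τ)) (Pullback.cone (∂ σ) (∂ τ))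

_^⊥ : ∀ {B} → (Prestrategy B → Set₁) → (Prestrategy B → Set₁)
(𝐒 ^⊥) τ = ∀ σ → 𝐒 σ → σ ⊥ τ

record UniformGroupoid : Set₂ where
  field
    G : Groupoid
    U : Prestrategy G → Set₁
    closedˡ : ∀ σ → ((U ^⊥) ^⊥) σ → U σ
    closedʳ : ∀ σ → U σ → ((U ^⊥) ^⊥) σ

open UniformGroupoid public

_×P_ : ∀ {A B} → Prestrategy A → Prestrategy B → Prestrategy (A ×G B)
σ ×P τ = record { S = S σ ×G S τ ; ∂ = ∂ σ ⁂ ∂ τ }

⊸Gen : (A B : UniformGroupoid) → Prestrategy (G A ×G G B) → Set₁
⊸Gen A B ω = Σ[ σ ∈ Prestrategy (G A) ] Σ[ τ ∈ Prestrategy (G B) ]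
               (U A σ × (U B ^⊥) τ × (ω ≡ σ ×P τ))

U⊸ : (A B : UniformGroupoid) → Prestrategy (G A ×G G B) → Set₁
U⊸ A B = ⊸Gen A B ^⊥

_⊙_ : ∀ {A B C} → Prestrategy (B ×G C) → Prestrategy (A ×G B) → Prestrategy (A ×G C)
τ ⊙ σ = record
  { S = Pullback.P u v
  ; ∂ = ⟨ (πˡ ∘F ∂ σ) ∘F Pullback.l u v , (πʳ ∘F ∂ τ) ∘F Pullback.r u v ⟩F
  }
  where
    u = πʳ ∘F ∂ σ
    v = πˡ ∘F ∂ τ

-- A strict pullback of groupoids is a bipullback exactly when every object
-- (s , t , φ : u s ≅ v t) of the iso-comma is isomorphic to one of the strict
-- pullback, so orthogonality becomes a lifting property.  Let σ' ∈ U_A and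
-- τ' ∈ U_C^⊥.  Restricting σ along σ' gives σ' ⊳ σ ∈ U_B: it lifts against
-- every ρ ∈ U_B^⊥ because σ lifts against σ' × ρ, and U_B^⊥⊥ = U_B.  Dually
-- τ ⊲ τ' ∈ U_B^⊥.  A lift of σ' × τ' against τ ⊙ σ is then obtained by lifting
-- first along σ ⊥ σ' × (τ ⊲ τ'), then along τ ⊥ (σ' ⊳ σ) × τ', and composing.
module Submission where

open import Data.Product using (Σ-syntax; _×_; _,_; proj₁; proj₂)
open import Data.Unit using (⊤; tt)
open import Relation.Binary.PropositionalEquality using (_≡_; refl; sym; cong; cong₂)

open import Defs

module GroupoidProperties (G : Groupoid) where
  open Groupoid G

  conj : ∀ {a b a' b'} → a ⇒ b → a' ⇒ b' → b ⇒ b' → a ⇒ a'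
  conj i i' f = i' ⁻¹ ∘ (f ∘ i)

  module _ {a b a' b'} {i : a ⇒ b} {i' : a' ⇒ b'} where

    conj-resp-≈ : {f g : b ⇒ b'} → f ≈ g → conj i i' f ≈ conj i i' g
    conj-resp-≈ f≈g = ∘-resp-≈ ≈refl (∘-resp-≈ f≈g ≈refl)

    conj-cancel : {f : b ⇒ b'} → i' ∘ conj i i' f ≈ f ∘ i
    conj-cancel = ≈sym assoc ▸ ∘-resp-≈ inverseʳ ≈refl ▸ identityˡ

  conj-id : ∀ {a b} {i : a ⇒ b} {f : b ⇒ b} → f ≈ id → conj i i f ≈ id
  conj-id f≈id = ∘-resp-≈ ≈refl (∘-resp-≈ f≈id ≈refl ▸ identityˡ) ▸ inverseˡ

  conj-∘ : ∀ {a b a' b' a'' b''} {i : a ⇒ b} {i' : a' ⇒ b'} {i'' : a'' ⇒ b''}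
             {f : b ⇒ b'} {g : b' ⇒ b''} →
           conj i i'' (g ∘ f) ≈ conj i' i'' g ∘ conj i i' f
  conj-∘ = ∘-resp-≈ ≈refl (assoc ▸ ∘-resp-≈ ≈refl (≈sym conj-cancel) ▸ ≈sym assoc)
           ▸ ≈sym assoc

  cast-sym-inverse : ∀ {x y} (e : x ≡ y) → cast {G} e ∘ cast {G} (sym e) ≈ id
  cast-sym-inverse refl = identityˡ

module _ {S T B : Groupoid} (u : Functor S B) (v : Functor T B) where
  private
    module S = Groupoid S
    module T = Groupoid T
    module B = Groupoid B

  Commutes : ∀ {s s' t t'} → B [ F₀ u s , F₀ v t ] → B [ F₀ u s' , F₀ v t' ] →
             S [ s , s' ] → T [ t , t' ] → Set
  Commutes μ μ' f g = B [ B [ μ' ∘ F₁ u f ] ≈ B [ F₁ v g ∘ μ ] ]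

  commutes-id : ∀ {s t} {μ : B [ F₀ u s , F₀ v t ]} → Commutes μ μ S.id T.id
  commutes-id = B.∘-resp-≈ B.≈refl (F-id u) B.▸ B.identityʳ
                B.▸ B.≈sym B.identityˡ B.▸ B.∘-resp-≈ (B.≈sym (F-id v)) B.≈refl

  commutes-∘ : ∀ {s₀ s₁ s₂ t₀ t₁ t₂} {μ₀ : B [ F₀ u s₀ , F₀ v t₀ ]}
                 {μ₁ : B [ F₀ u s₁ , F₀ v t₁ ]} {μ₂ : B [ F₀ u s₂ , F₀ v t₂ ]}
                 {f : S [ s₁ , s₂ ]} {f' : S [ s₀ , s₁ ]} {g : T [ t₁ , t₂ ]} {g' : T [ t₀ , t₁ ]} →
               Commutes μ₁ μ₂ f g → Commutes μ₀ μ₁ f' g' →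
               Commutes μ₀ μ₂ (S [ f ∘ f' ]) (T [ g ∘ g' ])
  commutes-∘ c c' = B.∘-resp-≈ B.≈refl (F-∘ u) B.▸ B.≈sym B.assoc
                    B.▸ B.∘-resp-≈ c B.≈refl B.▸ B.assoc
                    B.▸ B.∘-resp-≈ B.≈refl c' B.▸ B.≈sym B.assoc
                    B.▸ B.∘-resp-≈ (B.≈sym (F-∘ v)) B.≈refl

  commutes-⁻¹ : ∀ {s s' t t'} {μ : B [ F₀ u s , F₀ v t ]} {μ' : B [ F₀ u s' , F₀ v t' ]}
                  {f : S [ s , s' ]} {g : T [ t , t' ]} →
                Commutes μ μ' f g → Commutes μ' μ (f S.⁻¹) (g T.⁻¹)
  commutes-⁻¹ = B.square-inv
    (B.≈sym (F-∘ u) B.▸ F-resp-≈ u S.inverseʳ B.▸ F-id u)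
    (B.≈sym (F-∘ v) B.▸ F-resp-≈ v T.inverseˡ B.▸ F-id v)

commutes-transpose : ∀ {S T B} (u : Functor S B) (v : Functor T B) {s s' t t'}
                       {μ : B [ F₀ u s , F₀ v t ]} {μ' : B [ F₀ u s' , F₀ v t' ]}
                       {ν : B [ F₀ v t , F₀ u s ]} {ν' : B [ F₀ v t' , F₀ u s' ]}
                       {f : S [ s , s' ]} {g : T [ t , t' ]} →
                     B [ B [ μ ∘ ν ] ≈ Groupoid.id B ] → B [ B [ ν' ∘ μ' ] ≈ Groupoid.id B ] →
                     Commutes u v μ μ' f g → Commutes v u ν ν' g f
commutes-transpose {B = B} u v μν≈id ν'μ'≈id c =
  B.≈sym (B.square-inv μν≈id ν'μ'≈id (B.≈sym c))
  where module B = Groupoid B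

module _ {A B : Groupoid} where
  private
    module A = Groupoid A
    module B = Groupoid B
    module A×B = Groupoid (A ×G B)

  cast-× : ∀ {p q : Obj (A ×G B)} (e : p ≡ q) →
           (A ×G B) [ cast {A ×G B} e ≈ (cast {A} (cong proj₁ e) , cast {B} (cong proj₂ e)) ]
  cast-× refl = A.≈refl , B.≈refl

  cast-cong₂ : ∀ {a a' b b'} (p : a ≡ a') (q : b ≡ b') →
               (A ×G B) [ cast {A ×G B} (cong₂ _,_ p q) ≈ (cast {A} p , cast {B} q) ]
  cast-cong₂ refl refl = A.≈refl , B.≈refl

  module _ {p q p' q'} {h : (A ×G B) [ p , p' ]} {φ : (A ×G B) [ p' , q' ]}
           {k : (A ×G B) [ q , q' ]} (e : p ≡ q) (sq : φ A×B.∘ h A×B.≈ k A×B.∘ cast {A ×G B} e) where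

    cast-square-proj₁ : proj₁ φ A.∘ proj₁ h A.≈ proj₁ k A.∘ cast {A} (cong proj₁ e)
    cast-square-proj₁ = proj₁ sq A.▸ A.∘-resp-≈ A.≈refl (proj₁ (cast-× e))

    cast-square-proj₂ : proj₂ φ B.∘ proj₂ h B.≈ proj₂ k B.∘ cast {B} (cong proj₂ e)
    cast-square-proj₂ = proj₂ sq B.▸ B.∘-resp-≈ B.≈refl (proj₂ (cast-× e))

  cast-square-pair : ∀ {a a' b b' a₁ a₁' b₁ b₁'} (p : a ≡ a') (q : b ≡ b')
                       {h₁ : A [ a , a₁ ]} {φ₁ : A [ a₁ , a₁' ]} {k₁ : A [ a' , a₁' ]}
                       {h₂ : B [ b , b₁ ]} {φ₂ : B [ b₁ , b₁' ]} {k₂ : B [ b' , b₁' ]} →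
                     φ₁ A.∘ h₁ A.≈ k₁ A.∘ cast {A} p → φ₂ B.∘ h₂ B.≈ k₂ B.∘ cast {B} q →
                     (φ₁ , φ₂) A×B.∘ (h₁ , h₂) A×B.≈ (k₁ , k₂) A×B.∘ cast {A ×G B} (cong₂ _,_ p q)
  cast-square-pair p q sq₁ sq₂ =
    (sq₁ A.▸ A.∘-resp-≈ A.≈refl (A.≈sym (proj₁ (cast-cong₂ p q)))) ,
    (sq₂ B.▸ B.∘-resp-≈ B.≈refl (B.≈sym (proj₂ (cast-cong₂ p q))))

module IsoComma {S T B : Groupoid} (u : Functor S B) (v : Functor T B) where
  private
    module S = Groupoid S
    module T = Groupoid T
    module B = Groupoid B

  IObj : Set
  IObj = Σ[ s ∈ S.Obj ] Σ[ t ∈ T.Obj ] B [ F₀ u s , F₀ v t ]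

  record IHom (p q : IObj) : Set where
    constructor ihom
    field
      hs : S [ proj₁ p , proj₁ q ]
      ht : T [ proj₁ (proj₂ p) , proj₁ (proj₂ q) ]
      hc : Commutes u v (proj₂ (proj₂ p)) (proj₂ (proj₂ q)) hs ht
  open IHom

  P : Groupoid
  P = record
    { Obj = IObj
    ; _⇒_ = IHom
    ; _≈_ = λ f g → S [ hs f ≈ hs g ] × T [ ht f ≈ ht g ]
    ; ≈-equiv = record
        { refl = S.≈refl , T.≈refl
        ; sym = λ e → S.≈sym (proj₁ e) , T.≈sym (proj₂ e)
        ; trans = λ e e' → S.E.trans (proj₁ e) (proj₁ e') , T.E.trans (proj₂ e) (proj₂ e')
        }
    ; id = ihom S.id T.id (commutes-id u v)
    ; _∘_ = λ g f → ihom (S [ hs g ∘ hs f ]) (T [ ht g ∘ ht f ]) (commutes-∘ u v (hc g) (hc f))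
    ; _⁻¹ = λ f → ihom (hs f S.⁻¹) (ht f T.⁻¹) (commutes-⁻¹ u v (hc f))
    ; assoc = S.assoc , T.assoc
    ; identityˡ = S.identityˡ , T.identityˡ
    ; identityʳ = S.identityʳ , T.identityʳ
    ; ∘-resp-≈ = λ e e' → S.∘-resp-≈ (proj₁ e) (proj₁ e') , T.∘-resp-≈ (proj₂ e) (proj₂ e')
    ; inverseˡ = S.inverseˡ , T.inverseˡ
    ; inverseʳ = S.inverseʳ , T.inverseʳ
    }

  r : Functor P T
  r = record { F₀ = λ p → proj₁ (proj₂ p) ; F₁ = ht ; F-resp-≈ = proj₂
             ; F-id = T.≈refl ; F-∘ = T.≈refl }

unitGroupoid : Groupoid
unitGroupoid = record
  { Obj = ⊤ ; _⇒_ = λ _ _ → ⊤ ; _≈_ = λ _ _ → ⊤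
  ; ≈-equiv = record { refl = tt ; sym = λ _ → tt ; trans = λ _ _ → tt }
  ; id = tt ; _∘_ = λ _ _ → tt ; _⁻¹ = λ _ → tt
  ; assoc = tt ; identityˡ = tt ; identityʳ = tt ; ∘-resp-≈ = λ _ _ → tt
  ; inverseˡ = tt ; inverseʳ = tt }

const : ∀ {Y : Groupoid} → Obj Y → Functor unitGroupoid Y
const {Y} y = record { F₀ = λ _ → y ; F₁ = λ _ → Y.id ; F-resp-≈ = λ _ → Y.≈refl
                     ; F-id = Y.≈refl ; F-∘ = Y.≈sym Y.identityˡ }
  where module Y = Groupoid Y

module _ {S T B : Groupoid} (u : Functor S B) (v : Functor T B) where
  open Pullback u v using (PObj; μ₀; phom; cone)
  private
    module S = Groupoid S
    module T = Groupoid T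
    module SP = GroupoidProperties S
    module TP = GroupoidProperties T

  record Lift s t (φ : B [ F₀ u s , F₀ v t ]) : Set where
    constructor lift
    field
      point : PObj
      isoˡ : S [ proj₁ point , s ]
      isoʳ : T [ proj₁ (proj₂ point) , t ]
      square : Commutes u v (μ₀ point) φ isoˡ isoʳ

  EssSurj : Set
  EssSurj = ∀ s t (φ : B [ F₀ u s , F₀ v t ]) → Lift s t φ

  constPseudocone : ∀ {s t} → B [ F₀ u s , F₀ v t ] → Pseudocone u v unitGroupoid
  constPseudocone {s} {t} φ = record
    { l = const s ; r = const t
    ; ν = record { η = λ _ → φ ; commute = λ _ → commutes-id u v } }

  bipullback⇒essSurj : IsBipullback u v (Pullback.P u v) cone → EssSurj
  bipullback⇒essSurj bip s t φ with IsEquivalenceAt.essSurj (bip unitGroupoid) (constPseudocone φ)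
  ... | h , m = lift (F₀ h tt) (η (α m) tt) (η (β m) tt) (coh m tt)
    where open PseudoconeMor

  essSurj⇒bipullback : EssSurj → IsBipullback u v (Pullback.P u v) cone
  essSurj⇒bipullback lifts X = record
    { faithful = λ _ _ θ≈θ' → θ≈θ'
    ; full = λ m → record
        { η = λ x → phom (η (α m) x) (η (β m) x) (coh m x)
        ; commute = λ f → commute (α m) f , commute (β m) f }
        , λ _ → S.≈refl , T.≈refl
    ; essSurj = essSurj
    }
    where
      open PseudoconeMor

      essSurj : (d : Pseudocone u v X) →
                Σ[ h ∈ Functor X (Pullback.P u v) ] PseudoconeMor u v (precomp u v cone h) d
      essSurj d = h , record
          { α = record { η = isoˡ ; commute = λ _ → SP.conj-cancel }
          ; β = record { η = isoʳ ; commute = λ _ → TP.conj-cancel }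
          ; coh = square }
        where
          open Pseudocone d renaming (l to L; r to R; ν to N)
          module Λ (x : Obj X) = Lift (lifts (F₀ L x) (F₀ R x) (η N x))
          open Λ

          h : Functor X (Pullback.P u v)
          h = record
            { F₀ = point
            ; F₁ = λ {x} {x'} f →
                phom (SP.conj (isoˡ x) (isoˡ x') (F₁ L f)) (TP.conj (isoʳ x) (isoʳ x') (F₁ R f))
                     (commutes-∘ u v (commutes-⁻¹ u v (square x'))
                                     (commutes-∘ u v (commute N f) (square x)))
            ; F-resp-≈ = λ f≈g → SP.conj-resp-≈ (F-resp-≈ L f≈g) , TP.conj-resp-≈ (F-resp-≈ R f≈g)
            ; F-id = SP.conj-id (F-id L) , TP.conj-id (F-id R)
            ; F-∘ = (SP.conj-resp-≈ (F-∘ L) S.▸ SP.conj-∘) , (TP.conj-resp-≈ (F-∘ R) T.▸ TP.conj-∘)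
            }

open Pullback using (phom)
open IsoComma using (ihom)

_⊳_ : ∀ {A B} → Prestrategy A → Prestrategy (A ×G B) → Prestrategy B
σ' ⊳ σ = record
  { S = Pullback.P (∂ σ') (πˡ ∘F ∂ σ)
  ; ∂ = (πʳ ∘F ∂ σ) ∘F Pullback.r (∂ σ') (πˡ ∘F ∂ σ) }

-- An iso-comma rather than a strict pullback: the lift against τ ⊲ τ' in
-- essSurj-⊙ starts from an arbitrary isomorphism in C.
_⊲_ : ∀ {B C} → Prestrategy (B ×G C) → Prestrategy C → Prestrategy B
τ ⊲ τ' = record
  { S = IsoComma.P (∂ τ') (πʳ ∘F ∂ τ)
  ; ∂ = (πˡ ∘F ∂ τ) ∘F IsoComma.r (∂ τ') (πʳ ∘F ∂ τ) }

essSurj-⊳ : ∀ {A B} {σ' : Prestrategy A} {σ : Prestrategy (A ×G B)} {ρ : Prestrategy B} →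
            EssSurj (∂ σ' ⁂ ∂ ρ) (∂ σ) → EssSurj (∂ ρ) (∂ (σ' ⊳ σ))
essSurj-⊳ {A} {B} lifts x (a , s , e) ψ with lifts (a , x) s (cast {A} e , ψ)
... | lift ((a' , x') , s' , e') (i , j) m sq =
  lift (x' , (a' , s' , cong proj₁ e') , cong proj₂ e') j
       (phom i m (cast-square-proj₁ {A} {B} e' sq)) (cast-square-proj₂ {A} {B} e' sq)

essSurj-⊲ : ∀ {B C} {τ : Prestrategy (B ×G C)} {τ' : Prestrategy C} {ρ : Prestrategy B} →
            EssSurj (∂ ρ ⁂ ∂ τ') (∂ τ) → EssSurj (∂ ρ) (∂ (τ ⊲ τ'))
essSurj-⊲ {B} {C} lifts x (c , t , ψ) φ with lifts (x , c) t (φ , ψ)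
... | lift ((x' , c') , t' , e) (i , j) k sq =
  lift (x' , (c' , t' , cast {C} (cong proj₂ e)) , cong proj₁ e) i
       (ihom j k (cast-square-proj₂ {B} {C} e sq)) (cast-square-proj₁ {B} {C} e sq)

essSurj-⊙ : ∀ {A B C} {σ : Prestrategy (A ×G B)} {τ : Prestrategy (B ×G C)}
              {σ' : Prestrategy A} {τ' : Prestrategy C} →
            EssSurj (∂ σ' ⁂ ∂ (τ ⊲ τ')) (∂ σ) → EssSurj (∂ (σ' ⊳ σ) ⁂ ∂ τ') (∂ τ) →
            EssSurj (∂ σ' ⁂ ∂ τ') (∂ (τ ⊙ σ))
essSurj-⊙ {A} {B} {C} {σ} {τ} {σ'} {τ'} liftσ liftτ (a , c) (s , t , e) (φA , φC)
  with liftσ (a , (c , t , φC)) s (φA , cast {B} (sym e))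
... | lift ((a₁ , (c₁ , t₁ , ψ₁)) , s₁ , e₁) (i₁ , ihom j₁ k₁ sqC₁) m₁ sq₁
  with liftτ ((a₁ , s₁ , cong proj₁ e₁) , c₁) t₁ (cast {B} (sym (cong proj₂ e₁)) , ψ₁)
... | lift (((a₂ , s₂ , e₂ᴬ) , c₂) , t₂ , e₂) (phom i₂ m₂ sqA₂ , j₂) k₂ sq₂ =
  lift ((a₂ , c₂) , (s₂ , t₂ , cong proj₁ e₂) , cong₂ _,_ e₂ᴬ (cong proj₂ e₂))
       (S σ' [ i₁ ∘ i₂ ] , S τ' [ j₁ ∘ j₂ ])
       (phom (S σ [ m₁ ∘ m₂ ]) (S τ [ k₁ ∘ k₂ ]) squareB)
       (cast-square-pair {A} {C} e₂ᴬ (cong proj₂ e₂) squareA squareC)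
  where
    module BP = GroupoidProperties B
    σB : Functor (S σ) B
    σB = πʳ ∘F ∂ σ
    τB : Functor (S τ) B
    τB = πˡ ∘F ∂ τ

    squareA : Commutes (∂ σ') (πˡ ∘F ∂ σ) (cast {A} e₂ᴬ) φA (S σ' [ i₁ ∘ i₂ ]) (S σ [ m₁ ∘ m₂ ])
    squareA = commutes-∘ (∂ σ') (πˡ ∘F ∂ σ)
      (cast-square-proj₁ {A} {B} e₁ sq₁) sqA₂

    squareC : Commutes (∂ τ') (πʳ ∘F ∂ τ) (cast {C} (cong proj₂ e₂)) φC
                (S τ' [ j₁ ∘ j₂ ]) (S τ [ k₁ ∘ k₂ ])
    squareC = commutes-∘ (∂ τ') (πʳ ∘F ∂ τ)
      sqC₁ (cast-square-proj₂ {B} {C} e₂ sq₂)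

    squareB₁ : Commutes σB τB (cast {B} (sym (cong proj₂ e₁))) (cast {B} e) m₁ k₁
    squareB₁ = commutes-transpose τB σB (BP.cast-sym-inverse (cong proj₂ e₁)) (BP.cast-sym-inverse e)
      (cast-square-proj₂ {A} {B} e₁ sq₁)

    squareB : Commutes σB τB (cast {B} (cong proj₁ e₂)) (cast {B} e)
                (S σ [ m₁ ∘ m₂ ]) (S τ [ k₁ ∘ k₂ ])
    squareB = commutes-∘ σB τB squareB₁ (cast-square-proj₁ {B} {C} e₂ sq₂)

module _ (A B : UniformGroupoid) {σ : Prestrategy (G A ×G G B)} (σ∈U : U⊸ A B σ) where

  ⊸-essSurj : ∀ {σ' ρ} → U A σ' → (U B ^⊥) ρ → EssSurj (∂ σ' ⁂ ∂ ρ) (∂ σ)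
  ⊸-essSurj {σ'} {ρ} σ'∈U ρ∈U⊥ =
    bipullback⇒essSurj (∂ σ' ⁂ ∂ ρ) (∂ σ) (σ∈U (σ' ×P ρ) (σ' , ρ , σ'∈U , ρ∈U⊥ , refl))

  ⊳-∈U : ∀ {σ'} → U A σ' → U B (σ' ⊳ σ)
  ⊳-∈U {σ'} σ'∈U = closedˡ B (σ' ⊳ σ) λ ρ ρ∈U⊥ →
    essSurj⇒bipullback (∂ ρ) (∂ (σ' ⊳ σ)) (essSurj-⊳ {ρ = ρ} (⊸-essSurj σ'∈U ρ∈U⊥))

  ⊲-∈U⊥ : ∀ {τ'} → (U B ^⊥) τ' → (U A ^⊥) (σ ⊲ τ')
  ⊲-∈U⊥ {τ'} τ'∈U⊥ ρ ρ∈U =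
    essSurj⇒bipullback (∂ ρ) (∂ (σ ⊲ τ')) (essSurj-⊲ {ρ = ρ} (⊸-essSurj ρ∈U τ'∈U⊥))

proposition10 : (A B C : UniformGroupoid) (σ : Prestrategy (G A ×G G B)) (τ : Prestrategy (G B ×G G C)) →
    U⊸ A B σ → U⊸ B C τ → U⊸ A C (τ ⊙ σ)
proposition10 A B C σ τ σ∈U τ∈U _ (σ' , τ' , σ'∈U , τ'∈U⊥ , refl) =
  essSurj⇒bipullback (∂ σ' ⁂ ∂ τ') (∂ (τ ⊙ σ))
    (essSurj-⊙ (⊸-essSurj A B σ∈U σ'∈U (⊲-∈U⊥ B C τ∈U τ'∈U⊥))
               (⊸-essSurj B C τ∈U (⊳-∈U A B σ∈U σ'∈U) τ'∈U⊥))
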